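{- Let $\mathcal H^{mp}$ be the Hopf algebra of matroid perspectives, and let $\alpha(\mathbf a,\mathbf b)=\exp_*(\delta_{\mathbf a})*\exp_*(\delta_{\mathbf b})$ with $\delta_{\mathbf a}=x_1\delta_{cc}+x_2\delta_{ll}+x_3\delta_{cl}$ and $\delta_{\mathbf b}=y_1\delta_{cc}+y_2\delta_{ll}+y_3\delta_{cl}$. Then for every matroid perspective $\mathbf M=M\to M'$ with ground set $E$, where $r$ is the rank function of $M$ and $r'$ that of $M'$, $$\alpha(\mathbf a,\mathbf b)(\mathbf M)=x_1^{r'(E)}\,y_2^{|E|-r(E)}\,x_3^{r(E)-r'(E)}\,T_{\mathbf M}\Big(\frac{y_1}{x_1}+1,\frac{x_2}{y_2}+1,\frac{y_3}{x_3}\Big).$$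
   Context: A matroid perspective $M\to M'$ is a pair of matroids $M=(E,r)$, $M'=(E,r')$ on the same ground set with $r(B)-r(A)\ge r'(B)-r'(A)$ for all $A\subseteq B\subseteq E$; considered up to isomorphism. Deletion and contraction are componentwise: $(M\to M')\backslash A=M\backslash A\to M'\backslash A$, $(M\to M')/A=M/A\to M'/A$; direct sum is componentwise. $\mathcal H^{mp}$ is the free module (over a field of characteristic 0) spanned by isomorphism classes of matroid perspectives, graded by $|E|$, with multiplication direct sum, counit $1$ on the empty perspective and $0$ otherwise, and coproduct $\Delta(\mathbf M)=\sum_{A\subseteq E}\mathbf M\backslash A^c\otimes\mathbf M/A$. $\delta_{cc},\delta_{ll},\delta_{cl}$ are the linear maps equal to $1$ respectively on $U_{1,1}\to U_{1,1}$, on $U_{0,1}\to U_{0,1}$, on $U_{1,1}\to U_{0,1}$, and $0$ on all other perspectives. $f*g=m\circ(f\otimes g)\circ\Delta$, $\exp_*(\delta)=\sum_{k\ge0}\delta^{*k}/k!$ with $\delta^{*0}=\varepsilon$. Las Vergnas' Tutte polynomial: $T_{\mathbf M}(x,y,z)=\sum_{A\subseteq E}(x-1)^{r'(E)-r'(A)}(y-1)^{|A|-r(A)}z^{(r(E)-r(A))-(r'(E)-r'(A))}$. -}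

module Defs where

open import Data.Nat using (ℕ; zero; suc; _≤_; _∸_; _≡ᵇ_; _!)
import Data.Nat as ℕ
open import Data.Nat.Properties using (_!≢0)
open import Data.Bool using (Bool; true; false; if_then_else_; _∧_)
open import Data.Vec using (Vec; []; _∷_)
open import Data.List using (List; []; _∷_; map; _++_; foldr; upTo)
open import Data.Fin.Subset using (Subset; _⊆_; _∪_; _∩_; _─_; ∣_∣; ⊤)
open import Data.Integer using (+_)
open import Data.Rational using (ℚ; 0ℚ; 1ℚ; _+_; _*_; _-_; _/_)

record IsMatroid {n : ℕ} (r : Subset n → ℕ) : Set where
  field
    bounded    : ∀ A → r A ≤ ∣ A ∣
    monotone   : ∀ A B → A ⊆ B → r A ≤ r B
    submodular : ∀ A B → r (A ∪ B) ℕ.+ r (A ∩ B) ≤ r A ℕ.+ r B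

-- r(B) - r(A) ≥ r'(B) - r'(A) for A ⊆ B, written without subtraction
IsPerspective : {n : ℕ} → (Subset n → ℕ) → (Subset n → ℕ) → Set
IsPerspective {n} r r' = ∀ (A B : Subset n) → A ⊆ B → r' B ℕ.+ r A ≤ r B ℕ.+ r' A

-- A minor of a perspective on Fin n is represented by a ground
-- set S ⊆ Fin n together with rank functions on subsets of Fin n (only
-- their values on subsets of S matter).
--   restriction M \ A^c (A ⊆ S)  :  ground A,      ranks r, r'
--   contraction M / A  (A ⊆ S)   :  ground S ─ A,  ranks X ↦ r (X ∪ A) ∸ r A

contractRank : {n : ℕ} → (Subset n → ℕ) → Subset n → (Subset n → ℕ)
contractRank r A X = r (X ∪ A) ∸ r A

sumℚ : List ℚ → ℚ
sumℚ = foldr _+_ 0ℚ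

subsetsOf : {n : ℕ} → Subset n → List (Subset n)
subsetsOf [] = [] ∷ []
subsetsOf (true ∷ s)  = map (true ∷_) (subsetsOf s) ++ map (false ∷_) (subsetsOf s)
subsetsOf (false ∷ s) = map (false ∷_) (subsetsOf s)

-- Linear functionals on H^mp, given by their values on (minors of)
-- matroid perspectives: ground set, rank of M, rank of M'.

Fn : Set
Fn = ∀ {n : ℕ} → Subset n → (Subset n → ℕ) → (Subset n → ℕ) → ℚ

_⋆_ : Fn → Fn → Fn
(f ⋆ g) S r r' =
  sumℚ (map (λ A → f A r r' * g (S ─ A) (contractRank r A) (contractRank r' A))
           (subsetsOf S))

ε : Fn
ε S r r' = if ∣ S ∣ ≡ᵇ 0 then 1ℚ else 0ℚ

-- indicator of a one-element perspective with rank(M) = a, rank(M') = b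
-- (the isomorphism class of U_{a,1} → U_{b,1})
δ1 : ℕ → ℕ → Fn
δ1 a b S r r' =
  if (∣ S ∣ ≡ᵇ 1) ∧ (r S ≡ᵇ a) ∧ (r' S ≡ᵇ b) then 1ℚ else 0ℚ

δcc δll δcl : Fn
δcc = δ1 1 1
δll = δ1 0 0
δcl = δ1 1 0

lin : ℚ → ℚ → ℚ → Fn
lin c₁ c₂ c₃ S r r' = c₁ * δcc S r r' + c₂ * δll S r r' + c₃ * δcl S r r'

_⋆^_ : Fn → ℕ → Fn
(δ ⋆^ zero) = ε
(δ ⋆^ suc k) = δ ⋆ (δ ⋆^ k)

-- exp_*(δ)(M) = Σ_k δ^{*k}(M)/k!.  For δ vanishing on the empty
-- perspective (as all δ used here), δ^{*k}(M) = 0 when k > |E|, so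
-- the series is the finite sum over k ≤ |E|.
exp⋆ : Fn → Fn
exp⋆ δ S r r' =
  sumℚ (map (λ k → (δ ⋆^ k) S r r' * (_/_ (+ 1) (k !) ⦃ k !≢0 ⦄)) (upTo (suc ∣ S ∣)))

α : ℚ → ℚ → ℚ → ℚ → ℚ → ℚ → Fn
α x₁ x₂ x₃ y₁ y₂ y₃ = exp⋆ (lin x₁ x₂ x₃) ⋆ exp⋆ (lin y₁ y₂ y₃)

_^_ : ℚ → ℕ → ℚ
p ^ zero = 1ℚ
p ^ suc k = p * (p ^ k)

tutte : {n : ℕ} → Subset n → (Subset n → ℕ) → (Subset n → ℕ) → ℚ → ℚ → ℚ → ℚ
tutte E r r' x y z =
  sumℚ (map (λ A → ((x - 1ℚ) ^ (r' E ∸ r' A))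
                * ((y - 1ℚ) ^ (∣ A ∣ ∸ r A))
                * (z ^ ((r E ∸ r A) ∸ (r' E ∸ r' A))))
           (subsetsOf E))

-- δ = c₁ δcc + c₂ δll + c₃ δcl lives on one-element perspectives, so δ^{*k}(M) vanishes
-- unless k = |E|, and δ^{*|E|}(M) is a sum over the |E|! ways of contracting E one element
-- at a time.  Each contracted element is a coloop of both matroids (weight c₁), a loop of
-- both (weight c₂) or a coloop of M and a loop of M' (weight c₃), and whatever the order,
-- these kinds occur r'(E), |E| - r(E) and r(E) - r'(E) times.  Hence
-- exp_*(δ)(M) = c₁^{r'(E)} c₂^{|E|-r(E)} c₃^{r(E)-r'(E)}, and the A-summand
-- exp_*(δ_a)(M|A) exp_*(δ_b)(M/A) of α(M) is x₁^{r'(E)} y₂^{|E|-r(E)} x₃^{r(E)-r'(E)}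
-- times the A-summand of T_M(y₁/x₁ + 1, x₂/y₂ + 1, y₃/x₃).

module Submission where

open import Defs
open import Data.Bool using (true; false; if_then_else_; _∧_)
open import Data.Empty using (⊥-elim)
open import Data.Fin.Subset using (Subset; ⊤; ⊥; _∪_; _∩_; _─_; ∣_∣; _⊆_)
open import Data.Fin.Subset.Properties using (∪-identityˡ; ∣⊥∣≡0; ∣⊤∣≡n)
import Data.Integer as ℤ
open import Data.Integer.Properties using (pos-*)
open import Data.Integer.Tactic.RingSolver using (solve-∀)
open import Data.List using ([]; _∷_; map; _++_; applyUpTo)
import Data.List.Properties as List
open import Data.Nat as ℕ using (ℕ; zero; suc; _∸_; _≤_; _<_; _≡ᵇ_; _!; z≤n; s≤s)
import Data.Nat.Properties as ℕ
open import Data.Nat.Properties using (_!≢0)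
open import Data.Rational using (ℚ; NonZero; 0ℚ; 1ℚ; _+_; _*_; _/_; _÷_; _-_; -_; 1/_; toℚᵘ)
import Data.Rational.Properties as ℚ
open import Data.Rational.Solver using (module +-*-Solver)
import Data.Rational.Unnormalised as ℚᵘ
import Data.Rational.Unnormalised.Properties as ℚᵘ
open import Data.Vec.Base using ([]; _∷_; here; there)
open import Function using (_∘_; id)
open import Relation.Binary.PropositionalEquality
open import Relation.Nullary using (yes; no)

private variable
  n : ℕ
  A B C S X Y : Subset n

infix 4 _⊑_

-- Inclusion of subsets by recursion on their common length; unlike _⊆_ it can be
-- split along the same recursion as subsetsOf.
data _⊑_ : Subset n → Subset n → Set where
  []      : [] ⊑ []
  in∷in   : A ⊑ B → true ∷ A ⊑ true ∷ B
  out∷in  : A ⊑ B → false ∷ A ⊑ true ∷ B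
  out∷out : A ⊑ B → false ∷ A ⊑ false ∷ B

⊑⇒⊆ : A ⊑ B → A ⊆ B
⊑⇒⊆ (in∷in p)   here      = here
⊑⇒⊆ (in∷in p)   (there x) = there (⊑⇒⊆ p x)
⊑⇒⊆ (out∷in p)  (there x) = there (⊑⇒⊆ p x)
⊑⇒⊆ (out∷out p) (there x) = there (⊑⇒⊆ p x)

⊑-refl : (A : Subset n) → A ⊑ A
⊑-refl []          = []
⊑-refl (true ∷ A)  = in∷in (⊑-refl A)
⊑-refl (false ∷ A) = out∷out (⊑-refl A)

⊑-trans : A ⊑ B → B ⊑ C → A ⊑ C
⊑-trans []          []          = []
⊑-trans (in∷in p)   (in∷in q)   = in∷in (⊑-trans p q)
⊑-trans (out∷in p)  (in∷in q)   = out∷in (⊑-trans p q)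
⊑-trans (out∷out p) (out∷in q)  = out∷in (⊑-trans p q)
⊑-trans (out∷out p) (out∷out q) = out∷out (⊑-trans p q)

⊥⊑ : (A : Subset n) → ⊥ ⊑ A
⊥⊑ []          = []
⊥⊑ (true ∷ A)  = out∷in (⊥⊑ A)
⊥⊑ (false ∷ A) = out∷out (⊥⊑ A)

⊑⊤ : (A : Subset n) → A ⊑ ⊤
⊑⊤ []          = []
⊑⊤ (true ∷ A)  = in∷in (⊑⊤ A)
⊑⊤ (false ∷ A) = out∷in (⊑⊤ A)

∣p∣≡0⇒p≡⊥ : (A : Subset n) → ∣ A ∣ ≡ 0 → A ≡ ⊥
∣p∣≡0⇒p≡⊥ []          _ = refl
∣p∣≡0⇒p≡⊥ (false ∷ A) e = cong (false ∷_) (∣p∣≡0⇒p≡⊥ A e)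

[q─p]∪p≡q : A ⊑ B → (B ─ A) ∪ A ≡ B
[q─p]∪p≡q []          = refl
[q─p]∪p≡q (in∷in p)   = cong (true ∷_) ([q─p]∪p≡q p)
[q─p]∪p≡q (out∷in p)  = cong (true ∷_) ([q─p]∪p≡q p)
[q─p]∪p≡q (out∷out p) = cong (false ∷_) ([q─p]∪p≡q p)

p∪[q─p]≡q : A ⊑ B → A ∪ (B ─ A) ≡ B
p∪[q─p]≡q []          = refl
p∪[q─p]≡q (in∷in p)   = cong (true ∷_) (p∪[q─p]≡q p)
p∪[q─p]≡q (out∷in p)  = cong (true ∷_) (p∪[q─p]≡q p)
p∪[q─p]≡q (out∷out p) = cong (false ∷_) (p∪[q─p]≡q p)

p∩[q─p]≡⊥ : (A B : Subset n) → A ∩ (B ─ A) ≡ ⊥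
p∩[q─p]≡⊥ []          []      = refl
p∩[q─p]≡⊥ (true ∷ A)  (_ ∷ B) = cong (false ∷_) (p∩[q─p]≡⊥ A B)
p∩[q─p]≡⊥ (false ∷ A) (_ ∷ B) = cong (false ∷_) (p∩[q─p]≡⊥ A B)

∣q─p∣+∣p∣≡∣q∣ : A ⊑ B → ∣ B ─ A ∣ ℕ.+ ∣ A ∣ ≡ ∣ B ∣
∣q─p∣+∣p∣≡∣q∣ []          = refl
∣q─p∣+∣p∣≡∣q∣ {A = _ ∷ A} {_ ∷ B} (in∷in p) =
  trans (ℕ.+-suc ∣ B ─ A ∣ ∣ A ∣) (cong suc (∣q─p∣+∣p∣≡∣q∣ p))
∣q─p∣+∣p∣≡∣q∣ (out∷in p)  = cong suc (∣q─p∣+∣p∣≡∣q∣ p)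
∣q─p∣+∣p∣≡∣q∣ (out∷out p) = ∣q─p∣+∣p∣≡∣q∣ p

∣p∪q∣≡∣p∣+∣q∣ : A ⊑ S → X ⊑ S ─ A → ∣ X ∪ A ∣ ≡ ∣ X ∣ ℕ.+ ∣ A ∣
∣p∪q∣≡∣p∣+∣q∣ []          []          = refl
∣p∪q∣≡∣p∣+∣q∣ {A = _ ∷ A} {X = _ ∷ X} (in∷in p) (out∷out q) =
  trans (cong suc (∣p∪q∣≡∣p∣+∣q∣ p q)) (sym (ℕ.+-suc ∣ X ∣ ∣ A ∣))
∣p∪q∣≡∣p∣+∣q∣ (out∷in p)  (in∷in q)   = cong suc (∣p∪q∣≡∣p∣+∣q∣ p q)
∣p∪q∣≡∣p∣+∣q∣ (out∷in p)  (out∷in q)  = ∣p∪q∣≡∣p∣+∣q∣ p q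
∣p∪q∣≡∣p∣+∣q∣ (out∷out p) (out∷out q) = ∣p∪q∣≡∣p∣+∣q∣ p q

∪-monoˡ-⊑ : X ⊑ Y → X ∪ A ⊑ Y ∪ A
∪-monoˡ-⊑ {A = []}        []          = []
∪-monoˡ-⊑ {A = _ ∷ _}     (in∷in p)   = in∷in (∪-monoˡ-⊑ p)
∪-monoˡ-⊑ {A = true ∷ _}  (out∷in p)  = in∷in (∪-monoˡ-⊑ p)
∪-monoˡ-⊑ {A = false ∷ _} (out∷in p)  = out∷in (∪-monoˡ-⊑ p)
∪-monoˡ-⊑ {A = true ∷ _}  (out∷out p) = in∷in (∪-monoˡ-⊑ p)
∪-monoˡ-⊑ {A = false ∷ _} (out∷out p) = out∷out (∪-monoˡ-⊑ p)

q⊑p∪q : (X A : Subset n) → A ⊑ X ∪ A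
q⊑p∪q []          []          = []
q⊑p∪q (true ∷ X)  (true ∷ A)  = in∷in (q⊑p∪q X A)
q⊑p∪q (true ∷ X)  (false ∷ A) = out∷in (q⊑p∪q X A)
q⊑p∪q (false ∷ X) (true ∷ A)  = in∷in (q⊑p∪q X A)
q⊑p∪q (false ∷ X) (false ∷ A) = out∷out (q⊑p∪q X A)

p⊑r─q⇒p∪q⊑r : A ⊑ S → X ⊑ S ─ A → X ∪ A ⊑ S
p⊑r─q⇒p∪q⊑r []          []          = []
p⊑r─q⇒p∪q⊑r (in∷in p)   (out∷out q) = in∷in (p⊑r─q⇒p∪q⊑r p q)
p⊑r─q⇒p∪q⊑r (out∷in p)  (in∷in q)   = in∷in (p⊑r─q⇒p∪q⊑r p q)
p⊑r─q⇒p∪q⊑r (out∷in p)  (out∷in q)  = out∷in (p⊑r─q⇒p∪q⊑r p q)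
p⊑r─q⇒p∪q⊑r (out∷out p) (out∷out q) = out∷out (p⊑r─q⇒p∪q⊑r p q)

-- Perspectives on a subset and their minors

[m+n]∸[o+p]≡[m∸o]+[n∸p] : ∀ {m n o p} → o ≤ m → p ≤ n → (m ℕ.+ n) ∸ (o ℕ.+ p) ≡ (m ∸ o) ℕ.+ (n ∸ p)
[m+n]∸[o+p]≡[m∸o]+[n∸p] {m} {n} {o} {p} o≤m p≤n = begin
  (m ℕ.+ n) ∸ (o ℕ.+ p)  ≡⟨ ℕ.∸-+-assoc (m ℕ.+ n) o p ⟨
  (m ℕ.+ n) ∸ o ∸ p      ≡⟨ cong (_∸ p) (ℕ.+-∸-comm n o≤m) ⟩
  ((m ∸ o) ℕ.+ n) ∸ p    ≡⟨ ℕ.+-∸-assoc (m ∸ o) p≤n ⟩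
  (m ∸ o) ℕ.+ (n ∸ p)    ∎
  where open ≡-Reasoning

∸-+-mono-≤ : ∀ {a b p q s t} → a ≤ p → b ≤ q → a ≤ s → b ≤ t →
  p ℕ.+ q ≤ s ℕ.+ t → (p ∸ a) ℕ.+ (q ∸ b) ≤ (s ∸ a) ℕ.+ (t ∸ b)
∸-+-mono-≤ {a} {b} a≤p b≤q a≤s b≤t h =
  subst₂ _≤_ ([m+n]∸[o+p]≡[m∸o]+[n∸p] a≤p b≤q) ([m+n]∸[o+p]≡[m∸o]+[n∸p] a≤s b≤t)
    (ℕ.∸-monoˡ-≤ (a ℕ.+ b) h)

[m+n]∸o≡[m∸p]+[n∸[o∸p]] : ∀ {m n o p} → p ≤ m → p ≤ o → o ℕ.+ m ≤ p ℕ.+ (m ℕ.+ n) →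
  (m ℕ.+ n) ∸ o ≡ (m ∸ p) ℕ.+ (n ∸ (o ∸ p))
[m+n]∸o≡[m∸p]+[n∸[o∸p]] {m} {n} {o} {p} p≤m p≤o h = begin
  (m ℕ.+ n) ∸ o                ≡⟨ cong ((m ℕ.+ n) ∸_) (ℕ.m+[n∸m]≡n p≤o) ⟨
  (m ℕ.+ n) ∸ (p ℕ.+ (o ∸ p))  ≡⟨ [m+n]∸[o+p]≡[m∸o]+[n∸p] p≤m o∸p≤n ⟩
  (m ∸ p) ℕ.+ (n ∸ (o ∸ p))    ∎
  where
  open ≡-Reasoning
  o∸p≤n : o ∸ p ≤ n
  o∸p≤n = ℕ.m≤n+o⇒m∸n≤o o p (ℕ.+-cancelʳ-≤ m o (p ℕ.+ n)
    (subst (o ℕ.+ m ≤_) (trans (cong (p ℕ.+_) (ℕ.+-comm m n)) (sym (ℕ.+-assoc p n m))) h))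

-- The consequences of the matroid axioms that the argument needs, on the subsets
-- of S; unlike submodularity they pass directly to restrictions and contractions.
record IsPerspectiveOn {n : ℕ} (S : Subset n) (r r' : Subset n → ℕ) : Set where
  field
    r-monotone      : A ⊑ B → B ⊑ S → r A ≤ r B
    r'-monotone     : A ⊑ B → B ⊑ S → r' A ≤ r' B
    r-unit-increase : A ⊑ B → B ⊑ S → r B ℕ.+ ∣ A ∣ ≤ r A ℕ.+ ∣ B ∣
    perspective     : A ⊑ B → B ⊑ S → r' B ℕ.+ r A ≤ r B ℕ.+ r' A
    r-⊥             : r ⊥ ≡ 0
    r'-⊥            : r' ⊥ ≡ 0

  r≤∣∣ : A ⊑ S → r A ≤ ∣ A ∣
  r≤∣∣ {A = A} A⊑S = subst₂ _≤_
    (trans (cong (r A ℕ.+_) (∣⊥∣≡0 n)) (ℕ.+-identityʳ (r A))) (cong (ℕ._+ ∣ A ∣) r-⊥)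
    (r-unit-increase (⊥⊑ A) A⊑S)

  r'≤r : A ⊑ S → r' A ≤ r A
  r'≤r {A = A} A⊑S = subst₂ _≤_
    (trans (cong (r' A ℕ.+_) r-⊥) (ℕ.+-identityʳ (r' A)))
    (trans (cong (r A ℕ.+_) r'-⊥) (ℕ.+-identityʳ (r A)))
    (perspective (⊥⊑ A) A⊑S)

open IsPerspectiveOn

restriction : ∀ {r r'} → IsPerspectiveOn S r r' → A ⊑ S → IsPerspectiveOn A r r'
restriction P A⊑S = record
  { r-monotone      = λ p q → r-monotone P p (⊑-trans q A⊑S)
  ; r'-monotone     = λ p q → r'-monotone P p (⊑-trans q A⊑S)
  ; r-unit-increase = λ p q → r-unit-increase P p (⊑-trans q A⊑S)
  ; perspective     = λ p q → perspective P p (⊑-trans q A⊑S)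
  ; r-⊥             = r-⊥ P
  ; r'-⊥            = r'-⊥ P
  }

contraction : ∀ {r r'} → IsPerspectiveOn S r r' → A ⊑ S →
  IsPerspectiveOn (S ─ A) (contractRank r A) (contractRank r' A)
contraction {S = S} {A = A} {r} {r'} P A⊑S = record
  { r-monotone      = λ X⊑Y Y⊑S─A → ℕ.∸-monoˡ-≤ (r A) (r-monotone P (∪-monoˡ-⊑ X⊑Y) (∪⊑S Y⊑S─A))
  ; r'-monotone     = λ X⊑Y Y⊑S─A → ℕ.∸-monoˡ-≤ (r' A) (r'-monotone P (∪-monoˡ-⊑ X⊑Y) (∪⊑S Y⊑S─A))
  ; r-unit-increase = unit-increase
  ; perspective     = perspective′
  ; r-⊥             = ⊥-rank r
  ; r'-⊥            = ⊥-rank r'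
  }
  where
  ∪⊑S : X ⊑ S ─ A → X ∪ A ⊑ S
  ∪⊑S = p⊑r─q⇒p∪q⊑r A⊑S

  r-A≤ : X ⊑ S ─ A → r A ≤ r (X ∪ A)
  r-A≤ X⊑S─A = r-monotone P (q⊑p∪q _ A) (∪⊑S X⊑S─A)

  r'-A≤ : X ⊑ S ─ A → r' A ≤ r' (X ∪ A)
  r'-A≤ X⊑S─A = r'-monotone P (q⊑p∪q _ A) (∪⊑S X⊑S─A)

  ⊥-rank : (ρ : Subset _ → ℕ) → contractRank ρ A ⊥ ≡ 0
  ⊥-rank ρ = trans (cong (λ B → ρ B ∸ ρ A) (∪-identityˡ A)) (ℕ.n∸n≡0 (ρ A))

  unit-increase : X ⊑ Y → Y ⊑ S ─ A → contractRank r A Y ℕ.+ ∣ X ∣ ≤ contractRank r A X ℕ.+ ∣ Y ∣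
  unit-increase {X = X} {Y = Y} X⊑Y Y⊑S─A =
    ∸-+-mono-≤ {b = 0} (r-A≤ Y⊑S─A) z≤n (r-A≤ X⊑S─A) z≤n
      (ℕ.+-cancelʳ-≤ ∣ A ∣ _ _ (subst₂ _≤_ (disjoint Y X⊑S─A) (disjoint X Y⊑S─A)
        (r-unit-increase P (∪-monoˡ-⊑ X⊑Y) (∪⊑S Y⊑S─A))))
    where
    X⊑S─A = ⊑-trans X⊑Y Y⊑S─A
    disjoint : ∀ Z {W} → W ⊑ S ─ A → r (Z ∪ A) ℕ.+ ∣ W ∪ A ∣ ≡ r (Z ∪ A) ℕ.+ ∣ W ∣ ℕ.+ ∣ A ∣
    disjoint Z {W} W⊑S─A = trans (cong (r (Z ∪ A) ℕ.+_) (∣p∪q∣≡∣p∣+∣q∣ A⊑S W⊑S─A))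
                                 (sym (ℕ.+-assoc (r (Z ∪ A)) ∣ W ∣ ∣ A ∣))

  perspective′ : X ⊑ Y → Y ⊑ S ─ A →
    contractRank r' A Y ℕ.+ contractRank r A X ≤ contractRank r A Y ℕ.+ contractRank r' A X
  perspective′ {X = X} {Y = Y} X⊑Y Y⊑S─A =
    subst (contractRank r' A Y ℕ.+ contractRank r A X ≤_) (ℕ.+-comm (contractRank r' A X) (contractRank r A Y))
      (∸-+-mono-≤ (r'-A≤ Y⊑S─A) (r-A≤ X⊑S─A)
                  (r'-A≤ X⊑S─A) (r-A≤ Y⊑S─A)
        (subst (r' (Y ∪ A) ℕ.+ r (X ∪ A) ≤_) (ℕ.+-comm (r (Y ∪ A)) (r' (X ∪ A)))
          (perspective P (∪-monoˡ-⊑ X⊑Y) (∪⊑S Y⊑S─A))))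
    where X⊑S─A = ⊑-trans X⊑Y Y⊑S─A

isPerspectiveOn-⊤ : ∀ {r r'} → IsMatroid r → IsMatroid r' → IsPerspective r r' →
  IsPerspectiveOn (⊤ {n}) r r'
isPerspectiveOn-⊤ {n} {r} {r'} M M' P = record
  { r-monotone      = λ A⊑B _ → IsMatroid.monotone M _ _ (⊑⇒⊆ A⊑B)
  ; r'-monotone     = λ A⊑B _ → IsMatroid.monotone M' _ _ (⊑⇒⊆ A⊑B)
  ; r-unit-increase = λ A⊑B _ → unit-increase A⊑B
  ; perspective     = λ A⊑B _ → P _ _ (⊑⇒⊆ A⊑B)
  ; r-⊥             = ⊥-rank M
  ; r'-⊥            = ⊥-rank M'
  }
  where
  ⊥-rank : ∀ {ρ} → IsMatroid ρ → ρ ⊥ ≡ 0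
  ⊥-rank {ρ} N = ℕ.n≤0⇒n≡0 (subst (ρ ⊥ ≤_) (∣⊥∣≡0 n) (IsMatroid.bounded N ⊥))

  unit-increase : A ⊑ B → r B ℕ.+ ∣ A ∣ ≤ r A ℕ.+ ∣ B ∣
  unit-increase {A = A} {B = B} A⊑B = begin
    r B ℕ.+ ∣ A ∣                                 ≡⟨ cong (λ C → r C ℕ.+ ∣ A ∣) (p∪[q─p]≡q A⊑B) ⟨
    r (A ∪ (B ─ A)) ℕ.+ ∣ A ∣                     ≡⟨ cong (ℕ._+ ∣ A ∣) (ℕ.+-identityʳ _) ⟨
    r (A ∪ (B ─ A)) ℕ.+ 0 ℕ.+ ∣ A ∣               ≡⟨ cong (λ k → r (A ∪ (B ─ A)) ℕ.+ k ℕ.+ ∣ A ∣) r⊥≡0 ⟨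
    r (A ∪ (B ─ A)) ℕ.+ r ⊥ ℕ.+ ∣ A ∣             ≡⟨ cong (λ C → r (A ∪ (B ─ A)) ℕ.+ r C ℕ.+ ∣ A ∣) (p∩[q─p]≡⊥ A B) ⟨
    r (A ∪ (B ─ A)) ℕ.+ r (A ∩ (B ─ A)) ℕ.+ ∣ A ∣ ≤⟨ ℕ.+-monoˡ-≤ ∣ A ∣ (IsMatroid.submodular M A (B ─ A)) ⟩
    r A ℕ.+ r (B ─ A) ℕ.+ ∣ A ∣                   ≤⟨ ℕ.+-monoˡ-≤ ∣ A ∣ (ℕ.+-monoʳ-≤ (r A) (IsMatroid.bounded M (B ─ A))) ⟩
    r A ℕ.+ ∣ B ─ A ∣ ℕ.+ ∣ A ∣                   ≡⟨ ℕ.+-assoc (r A) ∣ B ─ A ∣ ∣ A ∣ ⟩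
    r A ℕ.+ (∣ B ─ A ∣ ℕ.+ ∣ A ∣)                 ≡⟨ cong (r A ℕ.+_) (∣q─p∣+∣p∣≡∣q∣ A⊑B) ⟩
    r A ℕ.+ ∣ B ∣                                 ∎
    where
    open ℕ.≤-Reasoning
    r⊥≡0 = ⊥-rank M

-- Sums over subsets

fromℕ : ℕ → ℚ
fromℕ k = ℤ.+ k / 1

toℚᵘ-fromℕ : ∀ k → toℚᵘ (fromℕ k) ℚᵘ.≃ ℚᵘ.mkℚᵘ (ℤ.+ k) 0
toℚᵘ-fromℕ k = ℚ.toℚᵘ-fromℚᵘ (ℚᵘ.mkℚᵘ (ℤ.+ k) 0)

fromℕ-suc : ∀ k → fromℕ (suc k) ≡ 1ℚ + fromℕ k
fromℕ-suc k = ℚ.toℚᵘ-injective (ℚᵘ.≃-sym (begin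
  toℚᵘ (1ℚ + fromℕ k)            ≈⟨ ℚ.toℚᵘ-homo-+ 1ℚ (fromℕ k) ⟩
  toℚᵘ 1ℚ ℚᵘ.+ toℚᵘ (fromℕ k)    ≈⟨ ℚᵘ.+-congʳ (toℚᵘ 1ℚ) (toℚᵘ-fromℕ k) ⟩
  ℚᵘ.1ℚᵘ ℚᵘ.+ ℚᵘ.mkℚᵘ (ℤ.+ k) 0  ≈⟨ ℚᵘ.*≡* (cross (ℤ.+ k)) ⟩
  ℚᵘ.mkℚᵘ (ℤ.+ suc k) 0          ≈⟨ toℚᵘ-fromℕ (suc k) ⟨
  toℚᵘ (fromℕ (suc k))           ∎))
  where
  open ℚᵘ.≃-Reasoning
  cross : ∀ x → ((ℤ.+ 1) ℤ.* (ℤ.+ 1) ℤ.+ x ℤ.* (ℤ.+ 1)) ℤ.* (ℤ.+ 1) ≡ ((ℤ.+ 1) ℤ.+ x) ℤ.* ((ℤ.+ 1) ℤ.* (ℤ.+ 1))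
  cross = solve-∀

fromℕ-* : ∀ a b → fromℕ (a ℕ.* b) ≡ fromℕ a * fromℕ b
fromℕ-* a b = ℚ.toℚᵘ-injective (begin
  toℚᵘ (fromℕ (a ℕ.* b))                      ≈⟨ toℚᵘ-fromℕ (a ℕ.* b) ⟩
  ℚᵘ.mkℚᵘ (ℤ.+ (a ℕ.* b)) 0                   ≈⟨ ℚᵘ.*≡* (cong (ℤ._* ℤ.+ 1) (pos-* a b)) ⟩
  ℚᵘ.mkℚᵘ (ℤ.+ a) 0 ℚᵘ.* ℚᵘ.mkℚᵘ (ℤ.+ b) 0    ≈⟨ ℚᵘ.*-cong (toℚᵘ-fromℕ a) (toℚᵘ-fromℕ b) ⟨
  toℚᵘ (fromℕ a) ℚᵘ.* toℚᵘ (fromℕ b)          ≈⟨ ℚ.toℚᵘ-homo-* (fromℕ a) (fromℕ b) ⟨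
  toℚᵘ (fromℕ a * fromℕ b)                    ∎)
  where open ℚᵘ.≃-Reasoning

fromℕ-*-1/ : ∀ k .{{_ : ℕ.NonZero k}} → fromℕ k * (ℤ.+ 1 / k) ≡ 1ℚ
fromℕ-*-1/ (suc k) = ℚ.toℚᵘ-injective (begin
  toℚᵘ (fromℕ (suc k) * (ℤ.+ 1 / suc k))
    ≈⟨ ℚ.toℚᵘ-homo-* (fromℕ (suc k)) (ℤ.+ 1 / suc k) ⟩
  toℚᵘ (fromℕ (suc k)) ℚᵘ.* toℚᵘ (ℤ.+ 1 / suc k)
    ≈⟨ ℚᵘ.*-cong (toℚᵘ-fromℕ (suc k)) (ℚ.toℚᵘ-fromℚᵘ (ℚᵘ.mkℚᵘ (ℤ.+ 1) k)) ⟩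
  ℚᵘ.mkℚᵘ (ℤ.+ suc k) 0 ℚᵘ.* ℚᵘ.mkℚᵘ (ℤ.+ 1) k
    ≈⟨ ℚᵘ.*≡* (cross (ℤ.+ suc k)) ⟩
  ℚᵘ.1ℚᵘ ∎)
  where
  open ℚᵘ.≃-Reasoning
  cross : ∀ x → (x ℤ.* (ℤ.+ 1)) ℤ.* (ℤ.+ 1) ≡ (ℤ.+ 1) ℤ.* ((ℤ.+ 1) ℤ.* x)
  cross = solve-∀

sumℚ-++ : ∀ xs ys → sumℚ (xs ++ ys) ≡ sumℚ xs + sumℚ ys
sumℚ-++ []       ys = sym (ℚ.+-identityˡ _)
sumℚ-++ (x ∷ xs) ys = trans (cong (x +_) (sumℚ-++ xs ys)) (sym (ℚ.+-assoc x _ _))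

*-distribˡ-sumℚ : ∀ {a} {I : Set a} k (f : I → ℚ) is → k * sumℚ (map f is) ≡ sumℚ (map ((k *_) ∘ f) is)
*-distribˡ-sumℚ k f []       = ℚ.*-zeroʳ k
*-distribˡ-sumℚ k f (i ∷ is) = trans (ℚ.*-distribˡ-+ k (f i) _) (cong (k * f i +_) (*-distribˡ-sumℚ k f is))

sumℚ-applyUpTo-last : ∀ m (g : ℕ → ℕ) (f : ℕ → ℚ) → (∀ {i} → i < m → f (g i) ≡ 0ℚ) →
  sumℚ (map f (applyUpTo g (suc m))) ≡ f (g m)
sumℚ-applyUpTo-last zero    g f _    = ℚ.+-identityʳ _
sumℚ-applyUpTo-last (suc m) g f vanish = trans
  (cong₂ _+_ (vanish (s≤s z≤n)) (sumℚ-applyUpTo-last m (g ∘ suc) f (vanish ∘ s≤s)))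
  (ℚ.+-identityˡ _)

module _ (h : Subset (suc n) → ℚ) (S : Subset n) where

  sumℚ-subsets-in : sumℚ (map h (subsetsOf (true ∷ S)))
    ≡ sumℚ (map (h ∘ (true ∷_)) (subsetsOf S)) + sumℚ (map (h ∘ (false ∷_)) (subsetsOf S))
  sumℚ-subsets-in = begin
    sumℚ (map h (map (true ∷_) (subsetsOf S) ++ map (false ∷_) (subsetsOf S)))
      ≡⟨ cong sumℚ (List.map-++ h (map (true ∷_) (subsetsOf S)) _) ⟩
    sumℚ (map h (map (true ∷_) (subsetsOf S)) ++ map h (map (false ∷_) (subsetsOf S)))
      ≡⟨ sumℚ-++ (map h (map (true ∷_) (subsetsOf S))) _ ⟩
    sumℚ (map h (map (true ∷_) (subsetsOf S))) + sumℚ (map h (map (false ∷_) (subsetsOf S)))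
      ≡⟨ cong₂ _+_ (cong sumℚ (List.map-∘ (subsetsOf S))) (cong sumℚ (List.map-∘ (subsetsOf S))) ⟨
    sumℚ (map (h ∘ (true ∷_)) (subsetsOf S)) + sumℚ (map (h ∘ (false ∷_)) (subsetsOf S)) ∎
    where open ≡-Reasoning

  sumℚ-subsets-out : sumℚ (map h (subsetsOf (false ∷ S))) ≡ sumℚ (map (h ∘ (false ∷_)) (subsetsOf S))
  sumℚ-subsets-out = cong sumℚ (sym (List.map-∘ (subsetsOf S)))

sumℚ-subsets-zero : (S : Subset n) (h : Subset n → ℚ) → (∀ {A} → A ⊑ S → h A ≡ 0ℚ) →
  sumℚ (map h (subsetsOf S)) ≡ 0ℚ
sumℚ-subsets-zero []          h z = cong (_+ 0ℚ) (z [])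
sumℚ-subsets-zero (true ∷ S)  h z = trans (sumℚ-subsets-in h S)
  (cong₂ _+_ (sumℚ-subsets-zero S _ (z ∘ in∷in)) (sumℚ-subsets-zero S _ (z ∘ out∷in)))
sumℚ-subsets-zero (false ∷ S) h z = trans (sumℚ-subsets-out h S)
  (sumℚ-subsets-zero S _ (z ∘ out∷out))

sumℚ-subsets-⊥ : (S : Subset n) (h : Subset n → ℚ) {w : ℚ} →
  (∀ {A} → A ⊑ S → ∣ A ∣ ≡ 0 → h A ≡ w) → (∀ {A} → A ⊑ S → ∣ A ∣ ≢ 0 → h A ≡ 0ℚ) →
  sumℚ (map h (subsetsOf S)) ≡ w
sumℚ-subsets-⊥ []          h on off = trans (cong (_+ 0ℚ) (on [] refl)) (ℚ.+-identityʳ _)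
sumℚ-subsets-⊥ (true ∷ S)  h on off = trans (sumℚ-subsets-in h S) (trans
  (cong₂ _+_ (sumℚ-subsets-zero S _ (λ A⊑S → off (in∷in A⊑S) λ ()))
             (sumℚ-subsets-⊥ S _ (on ∘ out∷in) (off ∘ out∷in)))
  (ℚ.+-identityˡ _))
sumℚ-subsets-⊥ (false ∷ S) h on off = trans (sumℚ-subsets-out h S)
  (sumℚ-subsets-⊥ S _ (on ∘ out∷out) (off ∘ out∷out))

sumℚ-subsets-singletons : (S : Subset n) (h : Subset n → ℚ) {v : ℚ} →
  (∀ {A} → A ⊑ S → ∣ A ∣ ≡ 1 → h A ≡ v) → (∀ {A} → A ⊑ S → ∣ A ∣ ≢ 1 → h A ≡ 0ℚ) →
  sumℚ (map h (subsetsOf S)) ≡ fromℕ ∣ S ∣ * v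
sumℚ-subsets-singletons []          h {v} on off =
  trans (cong (_+ 0ℚ) (off [] λ ())) (sym (ℚ.*-zeroˡ v))
sumℚ-subsets-singletons (true ∷ S)  h {v} on off = begin
  sumℚ (map h (subsetsOf (true ∷ S)))  ≡⟨ sumℚ-subsets-in h S ⟩
  _                                     ≡⟨ cong₂ _+_
      (sumℚ-subsets-⊥ S _ (λ A⊑S e → on (in∷in A⊑S) (cong suc e))
                          (λ A⊑S ne → off (in∷in A⊑S) (ne ∘ ℕ.suc-injective)))
      (sumℚ-subsets-singletons S _ (on ∘ out∷in) (off ∘ out∷in)) ⟩
  v + fromℕ ∣ S ∣ * v                   ≡⟨ cong (_+ fromℕ ∣ S ∣ * v) (ℚ.*-identityˡ v) ⟨
  1ℚ * v + fromℕ ∣ S ∣ * v              ≡⟨ ℚ.*-distribʳ-+ v 1ℚ (fromℕ ∣ S ∣) ⟨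
  (1ℚ + fromℕ ∣ S ∣) * v                ≡⟨ cong (_* v) (fromℕ-suc ∣ S ∣) ⟨
  fromℕ (suc ∣ S ∣) * v                 ∎
  where open ≡-Reasoning
sumℚ-subsets-singletons (false ∷ S) h on off = trans (sumℚ-subsets-out h S)
  (sumℚ-subsets-singletons S _ (on ∘ out∷out) (off ∘ out∷out))

-- Convolution powers and exponential of lin

monomial : ℚ → ℚ → ℚ → ℕ → ℕ → ℕ → ℚ
monomial c₁ c₂ c₃ k a b = c₁ ^ b * c₂ ^ (k ∸ a) * c₃ ^ (a ∸ b)

∣A∣≡1⇒∣S∣≡1+∣S─A∣ : ∀ {A S : Subset n} → A ⊑ S → ∣ A ∣ ≡ 1 → ∣ S ∣ ≡ suc ∣ S ─ A ∣
∣A∣≡1⇒∣S∣≡1+∣S─A∣ {A = A} {S} A⊑S e = begin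
  ∣ S ∣                ≡⟨ ∣q─p∣+∣p∣≡∣q∣ A⊑S ⟨
  ∣ S ─ A ∣ ℕ.+ ∣ A ∣  ≡⟨ cong (∣ S ─ A ∣ ℕ.+_) e ⟩
  ∣ S ─ A ∣ ℕ.+ 1      ≡⟨ ℕ.+-comm ∣ S ─ A ∣ 1 ⟩
  suc ∣ S ─ A ∣        ∎
  where open ≡-Reasoning

module _ (c₁ c₂ c₃ : ℚ) where

  open +-*-Solver

  private
    isOneElement : ℕ → ℕ → ℕ → ℕ → ℕ → ℚ
    isOneElement k a b u v = if (k ≡ᵇ 1) ∧ (a ≡ᵇ u) ∧ (b ≡ᵇ v) then 1ℚ else 0ℚ

    -- lin c₁ c₂ c₃ A r r' is definitionally linOn (∣ A ∣) (r A) (r' A).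
    linOn : ℕ → ℕ → ℕ → ℚ
    linOn k a b = c₁ * isOneElement k a b 1 1 + c₂ * isOneElement k a b 0 0 + c₃ * isOneElement k a b 1 0

    no-term : c₁ * 0ℚ + c₂ * 0ℚ + c₃ * 0ℚ ≡ 0ℚ
    no-term = solve 3 (λ x y z → x :* con 0ℚ :+ y :* con 0ℚ :+ z :* con 0ℚ := con 0ℚ) refl c₁ c₂ c₃

    linOn-≢1 : ∀ k a b → k ≢ 1 → linOn k a b ≡ 0ℚ
    linOn-≢1 zero          _ _ _  = no-term
    linOn-≢1 (suc zero)    _ _ ne = ⊥-elim (ne refl)
    linOn-≢1 (suc (suc k)) _ _ _  = no-term

    linOn-step : ∀ k s s' a a' → a ≤ 1 → a' ≤ a → a ≤ s → a' ≤ s' → s ≤ a ℕ.+ k → s' ℕ.+ a ≤ s ℕ.+ a' →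
      linOn 1 a a' * monomial c₁ c₂ c₃ k (s ∸ a) (s' ∸ a') ≡ monomial c₁ c₂ c₃ (suc k) s s'
    linOn-step k s s' 0 0 _ _ _ _ s≤k _ = begin
      linOn 1 0 0 * (c₁ ^ s' * c₂ ^ (k ∸ s) * c₃ ^ (s ∸ s'))
        ≡⟨ solve 6 (λ x y z P Q R → (x :* con 0ℚ :+ y :* con 1ℚ :+ z :* con 0ℚ) :* (P :* Q :* R)
                                     := P :* (y :* Q) :* R) refl c₁ c₂ c₃ (c₁ ^ s') (c₂ ^ (k ∸ s)) (c₃ ^ (s ∸ s')) ⟩
      c₁ ^ s' * c₂ ^ suc (k ∸ s) * c₃ ^ (s ∸ s')
        ≡⟨ cong (λ e → c₁ ^ s' * c₂ ^ e * c₃ ^ (s ∸ s')) (ℕ.+-∸-assoc 1 s≤k) ⟨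
      monomial c₁ c₂ c₃ (suc k) s s' ∎
      where open ≡-Reasoning
    linOn-step k (suc s) s' 1 0 _ _ _ _ _ s'+1≤1+s = begin
      linOn 1 1 0 * (c₁ ^ s' * c₂ ^ (k ∸ s) * c₃ ^ (s ∸ s'))
        ≡⟨ solve 6 (λ x y z P Q R → (x :* con 0ℚ :+ y :* con 0ℚ :+ z :* con 1ℚ) :* (P :* Q :* R)
                                     := P :* Q :* (z :* R)) refl c₁ c₂ c₃ (c₁ ^ s') (c₂ ^ (k ∸ s)) (c₃ ^ (s ∸ s')) ⟩
      c₁ ^ s' * c₂ ^ (k ∸ s) * c₃ ^ suc (s ∸ s')
        ≡⟨ cong (λ e → c₁ ^ s' * c₂ ^ (k ∸ s) * c₃ ^ e) (ℕ.+-∸-assoc 1 s'≤s) ⟨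
      monomial c₁ c₂ c₃ (suc k) (suc s) s' ∎
      where
      open ≡-Reasoning
      s'≤s : s' ≤ s
      s'≤s = ℕ.+-cancelʳ-≤ 1 s' s (subst (s' ℕ.+ 1 ≤_) (trans (ℕ.+-identityʳ (suc s)) (ℕ.+-comm 1 s)) s'+1≤1+s)
    linOn-step k (suc s) (suc s') 1 1 _ _ _ _ _ _ =
      solve 6 (λ x y z P Q R → (x :* con 1ℚ :+ y :* con 0ℚ :+ z :* con 0ℚ) :* (P :* Q :* R)
                               := (x :* P) :* Q :* R) refl c₁ c₂ c₃ (c₁ ^ s') (c₂ ^ (k ∸ s)) (c₃ ^ (s ∸ s'))
    linOn-step k zero    s'       1 _ _ _ () _ _ _
    linOn-step k (suc s) zero     1 1 _ _ _ () _ _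
    linOn-step k s       s'       0 (suc _) _ () _ _ _ _
    linOn-step k s       s'       1 (suc (suc _)) _ (s≤s ()) _ _ _ _
    linOn-step k s       s'       (suc (suc _)) _ (s≤s ()) _ _ _ _ _

  lin-monomial-step : ∀ {S A : Subset n} {r r'} → IsPerspectiveOn S r r' → A ⊑ S → ∣ A ∣ ≡ 1 →
    lin c₁ c₂ c₃ A r r' * monomial c₁ c₂ c₃ (∣ S ─ A ∣) (contractRank r A (S ─ A)) (contractRank r' A (S ─ A))
      ≡ monomial c₁ c₂ c₃ (∣ S ∣) (r S) (r' S)
  lin-monomial-step {S = S} {A} {r} {r'} P A⊑S ∣A∣≡1 = begin
    linOn (∣ A ∣) (r A) (r' A) * monomial c₁ c₂ c₃ (∣ S ─ A ∣) (r ((S ─ A) ∪ A) ∸ r A) (r' ((S ─ A) ∪ A) ∸ r' A)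
      ≡⟨ cong₂ (λ k B → linOn k (r A) (r' A) * monomial c₁ c₂ c₃ (∣ S ─ A ∣) (r B ∸ r A) (r' B ∸ r' A))
               ∣A∣≡1 ([q─p]∪p≡q A⊑S) ⟩
    linOn 1 (r A) (r' A) * monomial c₁ c₂ c₃ (∣ S ─ A ∣) (r S ∸ r A) (r' S ∸ r' A)
      ≡⟨ linOn-step (∣ S ─ A ∣) (r S) (r' S) (r A) (r' A) rA≤1 (r'≤r P A⊑S)
           (r-monotone P A⊑S S⊑S) (r'-monotone P A⊑S S⊑S) rS≤rA+∣S─A∣ (perspective P A⊑S S⊑S) ⟩
    monomial c₁ c₂ c₃ (suc (∣ S ─ A ∣)) (r S) (r' S)
      ≡⟨ cong (λ k → monomial c₁ c₂ c₃ k (r S) (r' S)) ∣S∣≡1+∣S─A∣ ⟨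
    monomial c₁ c₂ c₃ (∣ S ∣) (r S) (r' S) ∎
    where
    open ≡-Reasoning
    S⊑S = ⊑-refl S
    ∣S∣≡1+∣S─A∣ = ∣A∣≡1⇒∣S∣≡1+∣S─A∣ A⊑S ∣A∣≡1
    rA≤1 : r A ≤ 1
    rA≤1 = subst (r A ≤_) ∣A∣≡1 (r≤∣∣ P A⊑S)
    rS≤rA+∣S─A∣ : r S ≤ r A ℕ.+ ∣ S ─ A ∣
    rS≤rA+∣S─A∣ = ℕ.+-cancelʳ-≤ 1 (r S) (r A ℕ.+ ∣ S ─ A ∣)
      (subst₂ _≤_ (cong (r S ℕ.+_) ∣A∣≡1)
        (trans (cong (r A ℕ.+_) ∣S∣≡1+∣S─A∣) (trans (ℕ.+-suc (r A) _) (ℕ.+-comm 1 _)))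
        (r-unit-increase P A⊑S S⊑S))

  lin⋆^-off-diagonal : ∀ k (S : Subset n) r r' → k ≢ ∣ S ∣ → (lin c₁ c₂ c₃ ⋆^ k) S r r' ≡ 0ℚ
  lin⋆^-off-diagonal zero S r r' ne with ∣ S ∣
  ... | zero  = ⊥-elim (ne refl)
  ... | suc _ = refl
  lin⋆^-off-diagonal (suc k) S r r' ne = sumℚ-subsets-zero S _ term-vanishes
    where
    term-vanishes : ∀ {A} → A ⊑ S →
      lin c₁ c₂ c₃ A r r' * (lin c₁ c₂ c₃ ⋆^ k) (S ─ A) (contractRank r A) (contractRank r' A) ≡ 0ℚ
    term-vanishes {A} A⊑S with ∣ A ∣ ℕ.≟ 1
    ... | yes ∣A∣≡1 = trans
      (cong (lin c₁ c₂ c₃ A r r' *_) (lin⋆^-off-diagonal k (S ─ A) _ _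
        (λ k≡∣S─A∣ → ne (trans (cong suc k≡∣S─A∣) (sym (∣A∣≡1⇒∣S∣≡1+∣S─A∣ A⊑S ∣A∣≡1))))))
      (ℚ.*-zeroʳ (lin c₁ c₂ c₃ A r r'))
    ... | no ∣A∣≢1 = trans (cong (_* rest) (linOn-≢1 (∣ A ∣) (r A) (r' A) ∣A∣≢1)) (ℚ.*-zeroˡ rest)
      where rest = (lin c₁ c₂ c₃ ⋆^ k) (S ─ A) (contractRank r A) (contractRank r' A)

  lin⋆^-diagonal : ∀ m {S : Subset n} {r r'} → IsPerspectiveOn S r r' → ∣ S ∣ ≡ m →
    (lin c₁ c₂ c₃ ⋆^ m) S r r' ≡ fromℕ (m !) * monomial c₁ c₂ c₃ (∣ S ∣) (r S) (r' S)
  lin⋆^-diagonal zero {S} {r} {r'} P ∣S∣≡0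
    rewrite ∣S∣≡0 | ∣p∣≡0⇒p≡⊥ S ∣S∣≡0 | r-⊥ P | r'-⊥ P = refl
  lin⋆^-diagonal (suc m) {S} {r} {r'} P ∣S∣≡1+m = begin
    (lin c₁ c₂ c₃ ⋆^ suc m) S r r'
      ≡⟨ sumℚ-subsets-singletons S _ first-step other-steps ⟩
    fromℕ (∣ S ∣) * (fromℕ (m !) * M)
      ≡⟨ cong (λ k → fromℕ k * (fromℕ (m !) * M)) ∣S∣≡1+m ⟩
    fromℕ (suc m) * (fromℕ (m !) * M)
      ≡⟨ ℚ.*-assoc (fromℕ (suc m)) (fromℕ (m !)) M ⟨
    fromℕ (suc m) * fromℕ (m !) * M
      ≡⟨ cong (_* M) (fromℕ-* (suc m) (m !)) ⟨
    fromℕ (suc m !) * M ∎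
    where
    open ≡-Reasoning
    M = monomial c₁ c₂ c₃ (∣ S ∣) (r S) (r' S)

    first-step : ∀ {A} → A ⊑ S → ∣ A ∣ ≡ 1 →
      lin c₁ c₂ c₃ A r r' * (lin c₁ c₂ c₃ ⋆^ m) (S ─ A) (contractRank r A) (contractRank r' A) ≡ fromℕ (m !) * M
    first-step {A} A⊑S ∣A∣≡1 = begin
      δ * (lin c₁ c₂ c₃ ⋆^ m) (S ─ A) (contractRank r A) (contractRank r' A)
        ≡⟨ cong (δ *_) (lin⋆^-diagonal m (contraction P A⊑S)
             (ℕ.suc-injective (trans (sym (∣A∣≡1⇒∣S∣≡1+∣S─A∣ A⊑S ∣A∣≡1)) ∣S∣≡1+m))) ⟩
      δ * (fromℕ (m !) * M′)
        ≡⟨ solve 3 (λ x y z → x :* (y :* z) := y :* (x :* z)) refl δ (fromℕ (m !)) M′ ⟩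
      fromℕ (m !) * (δ * M′)
        ≡⟨ cong (fromℕ (m !) *_) (lin-monomial-step P A⊑S ∣A∣≡1) ⟩
      fromℕ (m !) * M ∎
      where
      δ  = lin c₁ c₂ c₃ A r r'
      M′ = monomial c₁ c₂ c₃ (∣ S ─ A ∣) (contractRank r A (S ─ A)) (contractRank r' A (S ─ A))

    other-steps : ∀ {A} → A ⊑ S → ∣ A ∣ ≢ 1 →
      lin c₁ c₂ c₃ A r r' * (lin c₁ c₂ c₃ ⋆^ m) (S ─ A) (contractRank r A) (contractRank r' A) ≡ 0ℚ
    other-steps {A} _ ∣A∣≢1 = trans (cong (_* rest) (linOn-≢1 (∣ A ∣) (r A) (r' A) ∣A∣≢1)) (ℚ.*-zeroˡ rest)
      where rest = (lin c₁ c₂ c₃ ⋆^ m) (S ─ A) (contractRank r A) (contractRank r' A)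

  exp⋆-lin : ∀ {S : Subset n} {r r'} → IsPerspectiveOn S r r' →
    exp⋆ (lin c₁ c₂ c₃) S r r' ≡ monomial c₁ c₂ c₃ (∣ S ∣) (r S) (r' S)
  exp⋆-lin {S = S} {r} {r'} P = begin
    exp⋆ (lin c₁ c₂ c₃) S r r'
      ≡⟨ sumℚ-applyUpTo-last (∣ S ∣) id term below-∣S∣ ⟩
    (lin c₁ c₂ c₃ ⋆^ ∣ S ∣) S r r' * 1/fact (∣ S ∣)
      ≡⟨ cong (_* 1/fact (∣ S ∣)) (lin⋆^-diagonal (∣ S ∣) P refl) ⟩
    fromℕ (∣ S ∣ !) * M * 1/fact (∣ S ∣)
      ≡⟨ solve 3 (λ x y z → x :* y :* z := y :* (x :* z)) refl (fromℕ (∣ S ∣ !)) M (1/fact (∣ S ∣)) ⟩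
    M * (fromℕ (∣ S ∣ !) * 1/fact (∣ S ∣))
      ≡⟨ cong (M *_) (fromℕ-*-1/ (∣ S ∣ !) ⦃ ∣ S ∣ !≢0 ⦄) ⟩
    M * 1ℚ
      ≡⟨ ℚ.*-identityʳ M ⟩
    M ∎
    where
    open ≡-Reasoning
    M = monomial c₁ c₂ c₃ (∣ S ∣) (r S) (r' S)
    1/fact : ℕ → ℚ
    1/fact k = _/_ (ℤ.+ 1) (k !) ⦃ k !≢0 ⦄
    term : ℕ → ℚ
    term k = (lin c₁ c₂ c₃ ⋆^ k) S r r' * 1/fact k
    below-∣S∣ : ∀ {k} → k < ∣ S ∣ → term k ≡ 0ℚ
    below-∣S∣ {k} k<∣S∣ = trans (cong (_* 1/fact k) (lin⋆^-off-diagonal k S r r' (ℕ.<⇒≢ k<∣S∣)))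
                               (ℚ.*-zeroˡ (1/fact k))

-- The summands of α

^-+ : ∀ x i j → x ^ (i ℕ.+ j) ≡ x ^ i * x ^ j
^-+ x zero    j = sym (ℚ.*-identityˡ (x ^ j))
^-+ x (suc i) j = trans (cong (x *_) (^-+ x i j)) (sym (ℚ.*-assoc x (x ^ i) (x ^ j)))

^-distribʳ-* : ∀ x y i → (x * y) ^ i ≡ x ^ i * y ^ i
^-distribʳ-* x y zero    = refl
^-distribʳ-* x y (suc i) = trans (cong ((x * y) *_) (^-distribʳ-* x y i))
  (solve 4 (λ x y X Y → (x :* y) :* (X :* Y) := (x :* X) :* (y :* Y)) refl x y (x ^ i) (y ^ i))
  where open +-*-Solver

x*[y÷x]≡y : ∀ x y .{{_ : NonZero x}} → x * (y ÷ x) ≡ y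
x*[y÷x]≡y x y = begin
  x * (y * 1/ x)  ≡⟨ cong (x *_) (ℚ.*-comm y (1/ x)) ⟩
  x * (1/ x * y)  ≡⟨ ℚ.*-assoc x (1/ x) y ⟨
  x * 1/ x * y    ≡⟨ cong (_* y) (ℚ.*-inverseʳ x) ⟩
  1ℚ * y          ≡⟨ ℚ.*-identityˡ y ⟩
  y               ∎
  where open ≡-Reasoning

x^i*[y÷x]^i≡y^i : ∀ x y .{{_ : NonZero x}} i → x ^ i * (y ÷ x) ^ i ≡ y ^ i
x^i*[y÷x]^i≡y^i x y i = trans (sym (^-distribʳ-* x (y ÷ x) i)) (cong (_^ i) (x*[y÷x]≡y x y))

[p+1]-1≡p : ∀ p → (p + 1ℚ) - 1ℚ ≡ p
[p+1]-1≡p p = trans (ℚ.+-assoc p 1ℚ (- 1ℚ)) (trans (cong (p +_) (ℚ.+-inverseʳ 1ℚ)) (ℚ.+-identityʳ p))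

tutteTerm : Subset n → (Subset n → ℕ) → (Subset n → ℕ) → ℚ → ℚ → ℚ → Subset n → ℚ
tutteTerm E r r' p q z A = p ^ (r' E ∸ r' A) * q ^ (∣ A ∣ ∸ r A) * z ^ ((r E ∸ r A) ∸ (r' E ∸ r' A))

tutte-shift : ∀ (E : Subset n) r r' p q z →
  tutte E r r' (p + 1ℚ) (q + 1ℚ) z ≡ sumℚ (map (tutteTerm E r r' p q z) (subsetsOf E))
tutte-shift E r r' p q z =
  cong₂ (λ p′ q′ → sumℚ (map (tutteTerm E r r' p′ q′ z) (subsetsOf E))) ([p+1]-1≡p p) ([p+1]-1≡p q)

module _ (x₁ x₂ x₃ y₁ y₂ y₃ : ℚ) .{{_ : NonZero x₁}} .{{_ : NonZero y₂}} .{{_ : NonZero x₃}} where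

  monomial-product : ∀ {n s t a b c d} → s ℕ.+ t ≡ n → c ≤ a → c ≤ d → a ≤ s → a ≤ b →
    b ℕ.+ s ≤ a ℕ.+ n → d ℕ.+ a ≤ b ℕ.+ c →
    monomial x₁ x₂ x₃ s a c * monomial y₁ y₂ y₃ t (b ∸ a) (d ∸ c)
      ≡ monomial x₁ y₂ x₃ n b d
        * ((y₁ ÷ x₁) ^ (d ∸ c) * (x₂ ÷ y₂) ^ (s ∸ a) * (y₃ ÷ x₃) ^ ((b ∸ a) ∸ (d ∸ c)))
  monomial-product {n} {s} {t} {a} {b} {c} {d} s+t≡n c≤a c≤d a≤s a≤b rank-bound perspective-bound =
    sym (begin
      (x₁ ^ d * y₂ ^ (n ∸ b) * x₃ ^ (b ∸ d)) * (Y₁ ^ w * X₂ ^ u * Y₃ ^ e)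
        ≡⟨ cong (λ K → K * (Y₁ ^ w * X₂ ^ u * Y₃ ^ e)) (cong₂ _*_ (cong₂ _*_
             (trans (cong (x₁ ^_) (sym (ℕ.m+[n∸m]≡n c≤d))) (^-+ x₁ c w))
             (trans (cong (y₂ ^_) n∸b≡u+v) (^-+ y₂ u v)))
             (trans (cong (x₃ ^_) b∸d≡p+e) (^-+ x₃ p e))) ⟩
      (x₁ ^ c * x₁ ^ w) * (y₂ ^ u * y₂ ^ v) * (x₃ ^ p * x₃ ^ e) * (Y₁ ^ w * X₂ ^ u * Y₃ ^ e)
        ≡⟨ solve 9 (λ A B C D E F G H I → (A :* B) :* (C :* D) :* (E :* F) :* (G :* H :* I)
                                          := (A :* (C :* H) :* E) :* ((B :* G) :* D :* (F :* I))) refl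
             (x₁ ^ c) (x₁ ^ w) (y₂ ^ u) (y₂ ^ v) (x₃ ^ p) (x₃ ^ e) (Y₁ ^ w) (X₂ ^ u) (Y₃ ^ e) ⟩
      (x₁ ^ c * (y₂ ^ u * X₂ ^ u) * x₃ ^ p) * ((x₁ ^ w * Y₁ ^ w) * y₂ ^ v * (x₃ ^ e * Y₃ ^ e))
        ≡⟨ cong₂ _*_ (cong (λ X → x₁ ^ c * X * x₃ ^ p) (x^i*[y÷x]^i≡y^i y₂ x₂ u))
                     (cong₂ (λ Y Z → Y * y₂ ^ v * Z) (x^i*[y÷x]^i≡y^i x₁ y₁ w) (x^i*[y÷x]^i≡y^i x₃ y₃ e)) ⟩
      monomial x₁ x₂ x₃ s a c * monomial y₁ y₂ y₃ t (b ∸ a) (d ∸ c) ∎)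
    where
    open ≡-Reasoning
    open +-*-Solver
    Y₁ = y₁ ÷ x₁
    X₂ = x₂ ÷ y₂
    Y₃ = y₃ ÷ x₃
    u = s ∸ a
    v = t ∸ (b ∸ a)
    w = d ∸ c
    p = a ∸ c
    e = (b ∸ a) ∸ w

    n∸b≡u+v : n ∸ b ≡ u ℕ.+ v
    n∸b≡u+v = trans (cong (_∸ b) (sym s+t≡n))
      ([m+n]∸o≡[m∸p]+[n∸[o∸p]] a≤s a≤b (subst (λ k → b ℕ.+ s ≤ a ℕ.+ k) (sym s+t≡n) rank-bound))

    b∸d≡p+e : b ∸ d ≡ p ℕ.+ e
    b∸d≡p+e = trans (cong (_∸ d) (sym a+[b∸a]≡b))
      ([m+n]∸o≡[m∸p]+[n∸[o∸p]] c≤a c≤d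
        (subst (d ℕ.+ a ≤_) (trans (ℕ.+-comm b c) (cong (c ℕ.+_) (sym a+[b∸a]≡b))) perspective-bound))
      where a+[b∸a]≡b = ℕ.m+[n∸m]≡n a≤b

  α-summand : ∀ {S A : Subset n} {r r'} → IsPerspectiveOn S r r' → A ⊑ S →
    exp⋆ (lin x₁ x₂ x₃) A r r' * exp⋆ (lin y₁ y₂ y₃) (S ─ A) (contractRank r A) (contractRank r' A)
      ≡ monomial x₁ y₂ x₃ (∣ S ∣) (r S) (r' S) * tutteTerm S r r' (y₁ ÷ x₁) (x₂ ÷ y₂) (y₃ ÷ x₃) A
  α-summand {S = S} {A} {r} {r'} P A⊑S = begin
    exp⋆ (lin x₁ x₂ x₃) A r r' * exp⋆ (lin y₁ y₂ y₃) (S ─ A) (contractRank r A) (contractRank r' A)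
      ≡⟨ cong₂ _*_ (exp⋆-lin x₁ x₂ x₃ (restriction P A⊑S)) (exp⋆-lin y₁ y₂ y₃ (contraction P A⊑S)) ⟩
    monomial x₁ x₂ x₃ (∣ A ∣) (r A) (r' A)
      * monomial y₁ y₂ y₃ (∣ S ─ A ∣) (r ((S ─ A) ∪ A) ∸ r A) (r' ((S ─ A) ∪ A) ∸ r' A)
      ≡⟨ cong (λ B → monomial x₁ x₂ x₃ (∣ A ∣) (r A) (r' A)
                      * monomial y₁ y₂ y₃ (∣ S ─ A ∣) (r B ∸ r A) (r' B ∸ r' A)) ([q─p]∪p≡q A⊑S) ⟩
    monomial x₁ x₂ x₃ (∣ A ∣) (r A) (r' A) * monomial y₁ y₂ y₃ (∣ S ─ A ∣) (r S ∸ r A) (r' S ∸ r' A)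
      ≡⟨ monomial-product ∣A∣+∣S─A∣≡∣S∣ (r'≤r P A⊑S) (r'-monotone P A⊑S S⊑S) (r≤∣∣ P A⊑S)
           (r-monotone P A⊑S S⊑S) (r-unit-increase P A⊑S S⊑S) (perspective P A⊑S S⊑S) ⟩
    monomial x₁ y₂ x₃ (∣ S ∣) (r S) (r' S) * tutteTerm S r r' (y₁ ÷ x₁) (x₂ ÷ y₂) (y₃ ÷ x₃) A ∎
    where
    open ≡-Reasoning
    S⊑S = ⊑-refl S
    ∣A∣+∣S─A∣≡∣S∣ : ∣ A ∣ ℕ.+ ∣ S ─ A ∣ ≡ ∣ S ∣
    ∣A∣+∣S─A∣≡∣S∣ = trans (ℕ.+-comm (∣ A ∣) _) (∣q─p∣+∣p∣≡∣q∣ A⊑S)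

theorem3p13 : (n : ℕ) (r r' : Subset n → ℕ) → IsMatroid r → IsMatroid r' → IsPerspective r r' →
    (x₁ x₂ x₃ y₁ y₂ y₃ : ℚ) → .⦃ _ : NonZero x₁ ⦄ → .⦃ _ : NonZero y₂ ⦄ → .⦃ _ : NonZero x₃ ⦄ →
    α x₁ x₂ x₃ y₁ y₂ y₃ ⊤ r r'
      ≡ (x₁ ^ r' ⊤) * (y₂ ^ (n ∸ r ⊤)) * (x₃ ^ (r ⊤ ∸ r' ⊤))
        * tutte ⊤ r r' ((y₁ ÷ x₁) + 1ℚ) ((x₂ ÷ y₂) + 1ℚ) (y₃ ÷ x₃)
theorem3p13 n r r' M M' P x₁ x₂ x₃ y₁ y₂ y₃ = begin
  α x₁ x₂ x₃ y₁ y₂ y₃ ⊤ r r'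
    ≡⟨ cong sumℚ (List.map-cong (λ A → α-summand x₁ x₂ x₃ y₁ y₂ y₃ P⊤ (⊑⊤ A)) (subsetsOf ⊤)) ⟩
  sumℚ (map ((K *_) ∘ term) (subsetsOf ⊤))
    ≡⟨ *-distribˡ-sumℚ K term (subsetsOf ⊤) ⟨
  K * sumℚ (map term (subsetsOf ⊤))
    ≡⟨ cong₂ (λ k t → x₁ ^ r' ⊤ * y₂ ^ (k ∸ r ⊤) * x₃ ^ (r ⊤ ∸ r' ⊤) * t)
             (∣⊤∣≡n n) (sym (tutte-shift ⊤ r r' (y₁ ÷ x₁) (x₂ ÷ y₂) (y₃ ÷ x₃))) ⟩
  x₁ ^ r' ⊤ * y₂ ^ (n ∸ r ⊤) * x₃ ^ (r ⊤ ∸ r' ⊤) * tutte ⊤ r r' (y₁ ÷ x₁ + 1ℚ) (x₂ ÷ y₂ + 1ℚ) (y₃ ÷ x₃) ∎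
  where
  open ≡-Reasoning
  P⊤ = isPerspectiveOn-⊤ M M' P
  K = monomial x₁ y₂ x₃ (∣ ⊤ {n} ∣) (r ⊤) (r' ⊤)
  term = tutteTerm ⊤ r r' (y₁ ÷ x₁) (x₂ ÷ y₂) (y₃ ÷ x₃)
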